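{- For any finite simple graphs $G$ and $H$ without vertices of degree 0, $$\gamma_{tR}(G\times H)\le 2\gamma_t(G)\gamma_t(H).$$
   Context: A total dominating set of $G$ is a set $D\subseteq V(G)$ such that every vertex of $G$ has a neighbor in $D$; $\gamma_t(G)$ is the minimum size of such a set. A function $f:V(G)\to\{0,1,2\}$ with $V_i=f^{ -1}(i)$ is a total Roman dominating function if every vertex in $V_0$ has a neighbor in $V_2$ and the subgraph induced by $V_1\cup V_2$ has no isolated vertices; $\gamma_{tR}(G)$ is the minimum of $\sum_v f(v)$ over such $f$. The direct product $G\times H$ has vertex set $V(G)\times V(H)$, with $(g,h)(g',h')$ an edge iff $gg'\in E(G)$ and $hh'\in E(H)$. -}

module Defs where

open import Data.Nat using (ℕ; zero; suc; _+_; _*_; _≤_)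
open import Data.Fin using (Fin; zero; suc)
open import Data.Fin.Subset using (Subset; _∈_; ∣_∣)
open import Data.Product using (Σ; ∃; ∃-syntax; _×_; _,_)
open import Relation.Nullary using (¬_; Dec)
open import Relation.Binary.PropositionalEquality using (_≡_)
open import Level using (0ℓ)

record Graph : Set₁ where
  field
    n      : ℕ
    Adj    : Fin n → Fin n → Set
    adj?   : ∀ u v → Dec (Adj u v)
    sym    : ∀ {u v} → Adj u v → Adj v u
    irrefl : ∀ {u} → ¬ Adj u u
open Graph public

NoIsolated : Graph → Set
NoIsolated G = ∀ (u : Fin (n G)) → ∃[ v ] Adj G u v

IsTotalDominating : (G : Graph) → Subset (n G) → Set
IsTotalDominating G D = ∀ (u : Fin (n G)) → ∃[ v ] (Adj G u v × v ∈ D)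

IsTotalDomNumber : Graph → ℕ → Set
IsTotalDomNumber G k =
  (∃[ D ] (IsTotalDominating G D × ∣ D ∣ ≡ k)) ×
  (∀ D → IsTotalDominating G D → k ≤ ∣ D ∣)

DVertex : Graph → Graph → Set
DVertex G H = Fin (n G) × Fin (n H)

DAdj : (G H : Graph) → DVertex G H → DVertex G H → Set
DAdj G H (g , h) (g' , h') = Adj G g g' × Adj H h h'

Label : Set
Label = Fin 3

val : Label → ℕ
val zero = 0
val (suc zero) = 1
val (suc (suc zero)) = 2

sumFin : (k : ℕ) → (Fin k → ℕ) → ℕ
sumFin zero f = 0
sumFin (suc k) f = f zero + sumFin k (λ i → f (suc i))

IsTRDF : (G H : Graph) → (DVertex G H → Label) → Set
IsTRDF G H f =
  (∀ x → f x ≡ zero → ∃[ y ] (DAdj G H x y × f y ≡ suc (suc zero))) ×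
  (∀ x → ¬ (f x ≡ zero) → ∃[ y ] (DAdj G H x y × ¬ (f y ≡ zero)))

weight : (G H : Graph) → (DVertex G H → Label) → ℕ
weight G H f = sumFin (n G) (λ g → sumFin (n H) (λ h → val (f (g , h))))

IsTRDomNumberProd : Graph → Graph → ℕ → Set
IsTRDomNumberProd G H k =
  (∃[ f ] (IsTRDF G H f × weight G H f ≡ k)) ×
  (∀ f → IsTRDF G H f → k ≤ weight G H f)

-- Take minimum total dominating sets D of G and E of H.  Every vertex (g , h)
-- of G × H has a neighbour g' ∈ D of g and a neighbour h' ∈ E of h, and then
-- (g' , h') ∈ D × E is a neighbour of (g , h); so D × E totally dominates G × H.
-- Labelling D × E by 2 and everything else by 0 gives a total Roman dominating
-- function: each vertex sees a 2, which serves both the 0-condition and the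
-- "no isolated positive vertex" condition.  Its weight is 2 ∣D∣ ∣E∣, so
-- minimality of γ_tR bounds it.
module Submission where

open import Defs hiding (sym)
open import Data.Nat using (ℕ; _*_; _≤_; zero; suc; _+_)
open import Data.Nat.Properties using (*-distribˡ-+; *-distribʳ-+; *-assoc; *-zeroʳ; *-identityˡ; ≤-trans; ≤-reflexive)
open import Data.Bool using (Bool; true; false; _∧_)
open import Data.Fin using (Fin; zero; suc)
open import Data.Fin.Subset using (Subset; ∣_∣)
open import Relation.Nullary using (¬_)
open import Data.Vec using ([]; _∷_; lookup)
open import Data.Vec.Properties using ([]=⇒lookup)
open import Data.Product using (∃-syntax; _×_; _,_; proj₁; proj₂)
open import Relation.Binary.PropositionalEquality using (_≡_; refl; sym; cong; cong₂; module ≡-Reasoning)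

sumFin-cong : ∀ k {f g : Fin k → ℕ} → (∀ i → f i ≡ g i) → sumFin k f ≡ sumFin k g
sumFin-cong zero    e = refl
sumFin-cong (suc k) e = cong₂ _+_ (e zero) (sumFin-cong k (λ i → e (suc i)))

sumFin-*ˡ : ∀ k c (f : Fin k → ℕ) → sumFin k (λ i → c * f i) ≡ c * sumFin k f
sumFin-*ˡ zero    c f = sym (*-zeroʳ c)
sumFin-*ˡ (suc k) c f
  rewrite sumFin-*ˡ k c (λ i → f (suc i)) = sym (*-distribˡ-+ c (f zero) _)

sumFin-*ʳ : ∀ k c (f : Fin k → ℕ) → sumFin k (λ i → f i * c) ≡ sumFin k f * c
sumFin-*ʳ zero    c f = refl
sumFin-*ʳ (suc k) c f
  rewrite sumFin-*ʳ k c (λ i → f (suc i)) = sym (*-distribʳ-+ c (f zero) _)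

sumFin-product : ∀ k l (u : Fin k → ℕ) (v : Fin l → ℕ) →
  sumFin k (λ i → sumFin l (λ j → u i * v j)) ≡ sumFin k u * sumFin l v
sumFin-product k l u v = begin
  sumFin k (λ i → sumFin l (λ j → u i * v j)) ≡⟨ sumFin-cong k (λ i → sumFin-*ˡ l (u i) v) ⟩
  sumFin k (λ i → u i * sumFin l v)           ≡⟨ sumFin-*ʳ k (sumFin l v) u ⟩
  sumFin k u * sumFin l v                     ∎
  where open ≡-Reasoning

χ : Bool → ℕ
χ true  = 1
χ false = 0

χ-∧ : ∀ x y → χ (x ∧ y) ≡ χ x * χ y
χ-∧ true  y = sym (*-identityˡ (χ y))
χ-∧ false y = refl

sumFin-χ : ∀ k (D : Subset k) → sumFin k (λ i → χ (lookup D i)) ≡ ∣ D ∣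
sumFin-χ zero    []          = refl
sumFin-χ (suc k) (true ∷ D)  = cong suc (sumFin-χ k D)
sumFin-χ (suc k) (false ∷ D) = sumFin-χ k D

product-totalDominating : (G H : Graph) (D : Subset (n G)) (E : Subset (n H)) →
  IsTotalDominating G D → IsTotalDominating H E →
  ∀ x → ∃[ y ] (DAdj G H x y × lookup D (proj₁ y) ≡ true × lookup E (proj₂ y) ≡ true)
product-totalDominating G H D E tdD tdE (g , h) with tdD g | tdE h
... | g' , g~g' , g'∈D | h' , h~h' , h'∈E =
  (g' , h') , (g~g' , h~h') , []=⇒lookup g'∈D , []=⇒lookup h'∈E

seesTwo⇒TRDF : (G H : Graph) (f : DVertex G H → Label) →
  (∀ x → ∃[ y ] (DAdj G H x y × f y ≡ suc (suc zero))) → IsTRDF G H f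
seesTwo⇒TRDF G H f sees = (λ x _ → sees x) , positiveNeighbour
  where
  two≢zero : ∀ {l : Label} → l ≡ suc (suc zero) → ¬ (l ≡ zero)
  two≢zero refl ()
  positiveNeighbour : ∀ x → ¬ (f x ≡ zero) → ∃[ y ] (DAdj G H x y × ¬ (f y ≡ zero))
  positiveNeighbour x _ with sees x
  ... | y , x~y , fy≡2 = y , x~y , two≢zero fy≡2

twoOn : Bool → Label
twoOn true  = suc (suc zero)
twoOn false = zero

val-twoOn : ∀ b → val (twoOn b) ≡ 2 * χ b
val-twoOn true  = refl
val-twoOn false = refl

productLabelling : (G H : Graph) → Subset (n G) → Subset (n H) → DVertex G H → Label
productLabelling G H D E (g , h) = twoOn (lookup D g ∧ lookup E h)

weight-productLabelling : (G H : Graph) (D : Subset (n G)) (E : Subset (n H)) →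
  weight G H (productLabelling G H D E) ≡ 2 * ∣ D ∣ * ∣ E ∣
weight-productLabelling G H D E = begin
  weight G H (productLabelling G H D E)
    ≡⟨ sumFin-cong (n G) (λ g → sumFin-cong (n H) (λ h → factor (lookup D g) (lookup E h))) ⟩
  sumFin (n G) (λ g → sumFin (n H) (λ h → 2 * χ (lookup D g) * χ (lookup E h)))
    ≡⟨ sumFin-product (n G) (n H) (λ g → 2 * χ (lookup D g)) (λ h → χ (lookup E h)) ⟩
  sumFin (n G) (λ g → 2 * χ (lookup D g)) * sumFin (n H) (λ h → χ (lookup E h))
    ≡⟨ cong₂ _*_ (sumFin-*ˡ (n G) 2 (λ g → χ (lookup D g))) (sumFin-χ (n H) E) ⟩
  2 * sumFin (n G) (λ g → χ (lookup D g)) * ∣ E ∣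
    ≡⟨ cong (λ d → 2 * d * ∣ E ∣) (sumFin-χ (n G) D) ⟩
  2 * ∣ D ∣ * ∣ E ∣ ∎
  where
  open ≡-Reasoning
  factor : ∀ x y → val (twoOn (x ∧ y)) ≡ 2 * χ x * χ y
  factor x y = begin
    val (twoOn (x ∧ y)) ≡⟨ val-twoOn (x ∧ y) ⟩
    2 * χ (x ∧ y)       ≡⟨ cong (2 *_) (χ-∧ x y) ⟩
    2 * (χ x * χ y)     ≡⟨ sym (*-assoc 2 (χ x) (χ y)) ⟩
    2 * χ x * χ y       ∎

corollary4 : (G H : Graph) → NoIsolated G → NoIsolated H →
    (a b c : ℕ) → IsTotalDomNumber G a → IsTotalDomNumber H b →
    IsTRDomNumberProd G H c → c ≤ 2 * a * b
corollary4 G H _ _ a b c ((D , tdD , ∣D∣≡a) , _) ((E , tdE , ∣E∣≡b) , _) (_ , c-minimal) =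
  ≤-trans (c-minimal f f-isTRDF) (≤-reflexive weight-f)
  where
  f : DVertex G H → Label
  f = productLabelling G H D E

  f-isTRDF : IsTRDF G H f
  f-isTRDF = seesTwo⇒TRDF G H f λ x →
    let (y , x~y , y₁∈D , y₂∈E) = product-totalDominating G H D E tdD tdE x
    in y , x~y , cong₂ (λ p q → twoOn (p ∧ q)) y₁∈D y₂∈E

  weight-f : weight G H f ≡ 2 * a * b
  weight-f rewrite sym ∣D∣≡a | sym ∣E∣≡b = weight-productLabelling G H D E
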